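{- Let $f$ be an $s$-term DNF with a fixed representation, let $K$ be a positive integer, and let $w_{\min}$ be the minimum width of a term of $f$. Let $T,T'$ be two terms of $f$ such that $|T|\le w_{\min}+K$ and $T,T'$ lie in different clusters of $\mathrm{Clustering}(f,K)$. Then $|T'\setminus T|>K$.
   Context: Terms are conjunctions of literals, viewed as sets of literals; no term contains both $x_i$ and $\overline{x_i}$; the width $|T|$ of a term is its number of literals. Fix a total (lexicographic) order on terms. The $K$-clustering $\mathrm{Clustering}(f,K)$ is produced by the following deterministic procedure on the set $L$ of terms of $f$: while $L\neq\emptyset$, pick the first term $T$ (in the fixed order) among the terms of $L$ of minimum width, remove it from $L$, and create a cluster $C=\{T\}$ with label $T^*=T$, $S^*=\emptyset$; then, while there exists $T'\in L$ with $|\{\ell\in T': \ell\notin T^*\cup S^*\}|\le 2K$, pick the first such $T'$, remove it from $L$, add it to $C$, and update simultaneously $T^*\leftarrow T^*\cap T'$ and $S^*\leftarrow S^*\cup\{\ell,\overline{\ell}:\ell\in T^*\triangle T'\}$ (with $T^*$ the value before the update); when no such $T'$ exists, the cluster $C$ with its current label is finished. The output is the collection of clusters. -}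

module Defs where

open import Data.Nat using (ℕ; zero; suc; _+_; _*_; _⊓_; _≤ᵇ_; _≡ᵇ_)
open import Data.Bool using (Bool; true; false; _∧_; _∨_; not; if_then_else_)
open import Data.Maybe using (Maybe; just; nothing)
open import Data.Product using (_×_; _,_)
open import Data.List using (List; []; _∷_; _++_; [_]; length; foldr)
open import Data.Vec using (Vec; zipWith; replicate)
  renaming ([] to []ᵥ; _∷_ to _∷ᵥ_)

-- A term (conjunction of literals containing no complementary pair)
-- is encoded as a vector: position i is
--   nothing     : neither x_i nor ¬x_i occurs,
--   just true   : the literal x_i occurs,
--   just false  : the literal ¬x_i occurs.

Term : ℕ → Set
Term n = Vec (Maybe Bool) n

-- A set of literals closed under negation (like S*) is determined by
-- its set of variables.
VarSet : ℕ → Set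
VarSet n = Vec Bool n

countTrue : ∀ {n} → Vec Bool n → ℕ
countTrue []ᵥ = 0
countTrue (true ∷ᵥ v) = suc (countTrue v)
countTrue (false ∷ᵥ v) = countTrue v

isJust : Maybe Bool → Bool
isJust (just _) = true
isJust nothing = false

eqB : Bool → Bool → Bool
eqB true true = true
eqB false false = true
eqB _ _ = false

eqMB : Maybe Bool → Maybe Bool → Bool
eqMB nothing nothing = true
eqMB (just a) (just b) = eqB a b
eqMB _ _ = false

width : ∀ {n} → Term n → ℕ
width T = countTrue (Data.Vec.map isJust T)

notInAt : Maybe Bool → Maybe Bool → Bool
notInAt t (just b) = not (eqMB t (just b))
notInAt t nothing = false

diffSize : ∀ {n} → Term n → Term n → ℕ
diffSize T' T = countTrue (zipWith notInAt T T')

-- |{ℓ ∈ T' : ℓ ∉ T* ∪ S*}|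
newLitsAt : Maybe Bool → Bool → Maybe Bool → Bool
newLitsAt t s t' = notInAt t t' ∧ not s

zipWith3 : ∀ {A B C D : Set} {n} → (A → B → C → D) → Vec A n → Vec B n → Vec C n → Vec D n
zipWith3 f []ᵥ []ᵥ []ᵥ = []ᵥ
zipWith3 f (a ∷ᵥ as) (b ∷ᵥ bs) (c ∷ᵥ cs) = f a b c ∷ᵥ zipWith3 f as bs cs

newLits : ∀ {n} → Term n → VarSet n → Term n → ℕ
newLits T* S* T' = countTrue (zipWith3 newLitsAt T* S* T')

meetAt : Maybe Bool → Maybe Bool → Maybe Bool
meetAt a b = if eqMB a b then a else nothing

meet : ∀ {n} → Term n → Term n → Term n
meet = zipWith meetAt

-- S* ∪ {ℓ, ¬ℓ : ℓ ∈ T* △ T'} : variable i is added iff T* and T' differ at i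
-- (T* i ≠ T' i exactly when some literal on x_i lies in T* △ T').
addSymDiff : ∀ {n} → VarSet n → Term n → Term n → VarSet n
addSymDiff S* T* T' = zipWith3 (λ s a b → s ∨ not (eqMB a b)) S* T* T'

-- The list L of terms is kept in the fixed total order; "the first term
-- satisfying P" is the first in the list.

extract : ∀ {A : Set} → (A → Bool) → List A → Maybe (A × List A)
extract p [] = nothing
extract p (x ∷ xs) with p x
... | true = just (x , xs)
... | false with extract p xs
...   | nothing = nothing
...   | just (y , ys) = just (y , x ∷ ys)

minWidth : ∀ {n} → List (Term n) → ℕ
minWidth [] = 0
minWidth (T ∷ L) = foldr (λ T' m → width T' ⊓ m) (width T) L

-- inner loop: grow a cluster (fuel = |L| suffices, each step removes a term)
grow : ∀ {n} → ℕ → ℕ → Term n → VarSet n → List (Term n) → List (Term n)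
     → List (Term n) × List (Term n)
grow K zero T* S* C L = C , L
grow K (suc fuel) T* S* C L with extract (λ T' → newLits T* S* T' ≤ᵇ 2 * K) L
... | nothing = C , L
... | just (T' , L') = grow K fuel (meet T* T') (addSymDiff S* T* T') (C ++ [ T' ]) L'

-- outer loop (fuel = |L| suffices)
clusterLoop : ∀ {n} → ℕ → ℕ → List (Term n) → List (List (Term n))
clusterLoop K zero L = []
clusterLoop K (suc fuel) L with extract (λ T → width T ≡ᵇ minWidth L) L
... | nothing = []
... | just (T , L') with grow K (length L') T (replicate _ false) [ T ] L'
...   | C , L'' = C ∷ clusterLoop K fuel L''

-- Clustering(f, K): the list of clusters (each a list of terms).
-- The DNF f is given as the list of its terms in the fixed total order.
Clustering : ∀ {n} → List (Term n) → ℕ → List (List (Term n))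
Clustering f K = clusterLoop K (length f) f

{-# OPTIONS --safe #-}
module Submission where

-- Once a term joins a cluster, all its literals lie in T* ∪ S*, and they stay there: the
-- update drops from T* only literals on which T* and T′ disagree, and then puts both
-- polarities of that variable into S*. So when the cluster is finished, every remaining
-- term has more than 2K literals outside T* ∪ S*, hence more than 2K literals outside each
-- member. Two terms at distance at most 2K in both directions therefore share a cluster.
-- Here |T′ ∖ T| ≤ K would give |T ∖ T′| = |T| − |T′| + |T′ ∖ T| ≤ 2K, since
-- |T| ≤ w_min + K ≤ |T′| + K.

open import Defs
open import Data.Nat using (ℕ; _+_; _≤_; _<_)
open import Data.List using (List)
open import Data.List.Membership.Propositional using (_∈_; _∉_)
open import Data.List.Relation.Unary.Unique.Propositional using (Unique)

open import Data.Bool using (Bool; true; false; _∨_; not; T)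
open import Data.Bool.Properties using (∧-zeroʳ)
open import Data.Maybe using (just; nothing)
open import Data.Nat using (zero; suc; _*_; _⊓_; _≤ᵇ_; _≡ᵇ_; z≤n; s≤s; s≤s⁻¹)
open import Data.Nat.Properties
open import Data.Nat.Tactic.RingSolver using (solve-∀)
open import Algebra.Properties.CommutativeSemigroup +-commutativeSemigroup using (interchange)
open import Data.Fin using (Fin; zero; suc)
open import Data.Vec using (Vec; []; _∷_; lookup; zipWith; replicate; map)
open import Data.Vec.Properties using (lookup-zipWith; lookup-replicate; lookup-map)
open import Data.List using ([]; _∷_; _++_; [_]; foldr; length) renaming (map to mapL)
open import Data.List.Properties using (foldr-map; foldr-preservesᵒ; ++-identityʳ; ++-assoc; length-++-≤ʳ)
open import Data.List.Relation.Unary.Any as Any using (Any; here; there)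
open import Data.List.Membership.Propositional.Properties using (∈-map⁺; ∈-map⁻; ∈-++⁻; foldr-selective)
open import Data.List.Relation.Unary.All as All using (All; []; _∷_)
open import Data.List.Relation.Unary.All.Properties using (++⁺)
open import Data.List.Relation.Binary.Permutation.Propositional using (_↭_; ↭-refl; ↭-prep; ↭-swap; ↭-trans)
open import Data.List.Relation.Binary.Permutation.Propositional.Properties using (↭-length; ∈-resp-↭)
open import Data.Product using (∃-syntax; _×_; _,_)
open import Data.Sum using (_⊎_; inj₁; inj₂; [_,_]′)
open import Relation.Binary.PropositionalEquality hiding ([_])
open import Relation.Nullary using (yes; no; contradiction)
open import Data.Empty using (⊥-elim)

toℕ : Bool → ℕ
toℕ false = 0
toℕ true = 1

countTrue-∷ : ∀ {n} b (v : Vec Bool n) → countTrue (b ∷ v) ≡ toℕ b + countTrue v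
countTrue-∷ false v = refl
countTrue-∷ true v = refl

eqMB-sound : ∀ {a b} → eqMB a b ≡ true → a ≡ b
eqMB-sound {nothing} {nothing} _ = refl
eqMB-sound {just true} {just true} _ = refl
eqMB-sound {just false} {just false} _ = refl
eqMB-sound {nothing} {just _} ()
eqMB-sound {just _} {nothing} ()
eqMB-sound {just true} {just false} ()
eqMB-sound {just false} {just true} ()

newLitsAt-self : ∀ t → newLitsAt t false t ≡ false
newLitsAt-self nothing = refl
newLitsAt-self (just true) = refl
newLitsAt-self (just false) = refl

newLitsAt-true : ∀ t y → newLitsAt t true y ≡ false
newLitsAt-true t y = ∧-zeroʳ (notInAt t y)

newLitsAt-update : ∀ t s t′ y → newLitsAt t s y ≡ false →
                   newLitsAt (meetAt t t′) (s ∨ not (eqMB t t′)) y ≡ false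
newLitsAt-update t true t′ y _ = newLitsAt-true _ y
newLitsAt-update t false t′ y old with eqMB t t′
... | true = old
... | false = newLitsAt-true _ y

newLitsAt-added : ∀ t s t′ → newLitsAt (meetAt t t′) (s ∨ not (eqMB t t′)) t′ ≡ false
newLitsAt-added t true t′ = newLitsAt-true _ t′
newLitsAt-added t false t′ with eqMB t t′ in t≟t′
... | true = subst (λ u → newLitsAt u false t′ ≡ false) (sym (eqMB-sound t≟t′)) (newLitsAt-self t′)
... | false = newLitsAt-true _ t′

newLitsAt⇒notInAt : ∀ t s y x → newLitsAt t s y ≡ false → newLitsAt t s x ≡ true →
                    notInAt y x ≡ true
newLitsAt⇒notInAt t s y nothing _ ()
newLitsAt⇒notInAt t s y (just b) y-old x-new with eqMB y (just b) in y≟x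
... | false = refl
... | true = contradiction (trans (sym y-old) y-new) λ ()
  where
    y-new : newLitsAt t s y ≡ true
    y-new = subst (λ u → newLitsAt t s u ≡ true) (sym (eqMB-sound {y} y≟x)) x-new

notInAt-isJust : ∀ a b → toℕ (notInAt b a) + toℕ (isJust b) ≡ toℕ (isJust a) + toℕ (notInAt a b)
notInAt-isJust nothing nothing = refl
notInAt-isJust nothing (just true) = refl
notInAt-isJust nothing (just false) = refl
notInAt-isJust (just true) nothing = refl
notInAt-isJust (just true) (just true) = refl
notInAt-isJust (just true) (just false) = refl
notInAt-isJust (just false) nothing = refl
notInAt-isJust (just false) (just true) = refl
notInAt-isJust (just false) (just false) = refl

lookup-zipWith3 : ∀ {A B C D : Set} {n} (f : A → B → C → D) (i : Fin n) as bs cs →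
                  lookup (zipWith3 f as bs cs) i ≡ f (lookup as i) (lookup bs i) (lookup cs i)
lookup-zipWith3 f zero (a ∷ as) (b ∷ bs) (c ∷ cs) = refl
lookup-zipWith3 f (suc i) (a ∷ as) (b ∷ bs) (c ∷ cs) = lookup-zipWith3 f i as bs cs

countTrue-mono : ∀ {n} (u v : Vec Bool n) → (∀ i → lookup u i ≡ true → lookup v i ≡ true) →
                 countTrue u ≤ countTrue v
countTrue-mono [] [] _ = z≤n
countTrue-mono (true ∷ u) (true ∷ v) u⇒v = s≤s (countTrue-mono u v (λ i → u⇒v (suc i)))
countTrue-mono (false ∷ u) (true ∷ v) u⇒v = m≤n⇒m≤1+n (countTrue-mono u v (λ i → u⇒v (suc i)))
countTrue-mono (false ∷ u) (false ∷ v) u⇒v = countTrue-mono u v (λ i → u⇒v (suc i))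
countTrue-mono (true ∷ u) (false ∷ v) u⇒v with u⇒v zero refl
... | ()

countTrue-interchange : ∀ {n} (u v u′ v′ : Vec Bool n) →
  (∀ i → toℕ (lookup u i) + toℕ (lookup v i) ≡ toℕ (lookup u′ i) + toℕ (lookup v′ i)) →
  countTrue u + countTrue v ≡ countTrue u′ + countTrue v′
countTrue-interchange [] [] [] [] _ = refl
countTrue-interchange (x ∷ u) (y ∷ v) (x′ ∷ u′) (y′ ∷ v′) pointwise = begin
  countTrue (x ∷ u) + countTrue (y ∷ v)
    ≡⟨ cong₂ _+_ (countTrue-∷ x u) (countTrue-∷ y v) ⟩
  (toℕ x + countTrue u) + (toℕ y + countTrue v)
    ≡⟨ interchange (toℕ x) (countTrue u) (toℕ y) (countTrue v) ⟩
  (toℕ x + toℕ y) + (countTrue u + countTrue v)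
    ≡⟨ cong₂ _+_ (pointwise zero) (countTrue-interchange u v u′ v′ (λ i → pointwise (suc i))) ⟩
  (toℕ x′ + toℕ y′) + (countTrue u′ + countTrue v′)
    ≡⟨ interchange (toℕ x′) (toℕ y′) (countTrue u′) (countTrue v′) ⟩
  (toℕ x′ + countTrue u′) + (toℕ y′ + countTrue v′)
    ≡⟨ cong₂ _+_ (countTrue-∷ x′ u′) (countTrue-∷ y′ v′) ⟨
  countTrue (x′ ∷ u′) + countTrue (y′ ∷ v′) ∎
  where open ≡-Reasoning

diffSize-width : ∀ {n} (A B : Term n) → diffSize A B + width B ≡ width A + diffSize B A
diffSize-width A B =
  countTrue-interchange (zipWith notInAt B A) (map isJust B) (map isJust A) (zipWith notInAt A B)
    λ i → begin
      toℕ (lookup (zipWith notInAt B A) i) + toℕ (lookup (map isJust B) i)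
        ≡⟨ cong₂ (λ u v → toℕ u + toℕ v) (lookup-zipWith notInAt i B A) (lookup-map i isJust B) ⟩
      toℕ (notInAt (lookup B i) (lookup A i)) + toℕ (isJust (lookup B i))
        ≡⟨ notInAt-isJust (lookup A i) (lookup B i) ⟩
      toℕ (isJust (lookup A i)) + toℕ (notInAt (lookup A i) (lookup B i))
        ≡⟨ cong₂ (λ u v → toℕ u + toℕ v) (lookup-map i isJust A) (lookup-zipWith notInAt i A B) ⟨
      toℕ (lookup (map isJust A) i) + toℕ (lookup (zipWith notInAt A B) i) ∎
  where open ≡-Reasoning

Covered : ∀ {n} → Term n → VarSet n → Term n → Set
Covered T* S* y = ∀ i → newLitsAt (lookup T* i) (lookup S* i) (lookup y i) ≡ false

covered-initial : ∀ {n} (T : Term n) → Covered T (replicate n false) T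
covered-initial {n} T i rewrite lookup-replicate i false = newLitsAt-self (lookup T i)

module _ {n} (T* : Term n) (S* : VarSet n) (T′ : Term n) where

  private
    lookup-label : ∀ i → lookup (meet T* T′) i ≡ meetAt (lookup T* i) (lookup T′ i)
    lookup-label i = lookup-zipWith meetAt i T* T′

    lookup-labelVars : ∀ i →
      lookup (addSymDiff S* T* T′) i ≡ lookup S* i ∨ not (eqMB (lookup T* i) (lookup T′ i))
    lookup-labelVars i = lookup-zipWith3 _ i S* T* T′

  covered-update : ∀ y → Covered T* S* y → Covered (meet T* T′) (addSymDiff S* T* T′) y
  covered-update y y-covered i rewrite lookup-label i | lookup-labelVars i =
    newLitsAt-update (lookup T* i) (lookup S* i) (lookup T′ i) (lookup y i) (y-covered i)

  covered-added : Covered (meet T* T′) (addSymDiff S* T* T′) T′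
  covered-added i rewrite lookup-label i | lookup-labelVars i =
    newLitsAt-added (lookup T* i) (lookup S* i) (lookup T′ i)

newLits≤diffSize : ∀ {n} (T* : Term n) S* y → Covered T* S* y → ∀ x → newLits T* S* x ≤ diffSize x y
newLits≤diffSize T* S* y y-covered x =
  countTrue-mono (zipWith3 newLitsAt T* S* x) (zipWith notInAt y x) λ i x-new →
    trans (lookup-zipWith notInAt i y x)
          (newLitsAt⇒notInAt (lookup T* i) (lookup S* i) (lookup y i) (lookup x i) (y-covered i)
                             (trans (sym (lookup-zipWith3 newLitsAt i T* S* x)) x-new))

minWidth-∷ : ∀ {n} (T : Term n) L → minWidth (T ∷ L) ≡ foldr _⊓_ (width T) (mapL width L)
minWidth-∷ T L = sym (foldr-map _⊓_ width (width T) L)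

minWidth-≤ : ∀ {n} (L : List (Term n)) {x} → x ∈ L → minWidth L ≤ width x
minWidth-≤ (T ∷ L) {x} x∈ rewrite minWidth-∷ T L =
  foldr-preservesᵒ (λ a b → [ m≤n⇒m⊓o≤n b , m≤n⇒o⊓m≤n a ]′) (width T) (mapL width L) (witness x∈)
  where
    witness : x ∈ T ∷ L → width T ≤ width x ⊎ Any (_≤ width x) (mapL width L)
    witness (here refl) = inj₁ ≤-refl
    witness (there x∈L) = inj₂ (Any.map (λ eq → ≤-reflexive (sym eq)) (∈-map⁺ width x∈L))

minWidth-attained : ∀ {n} (L : List (Term n)) {x} → x ∈ L → ∃[ m ] m ∈ L × width m ≡ minWidth L
minWidth-attained (T ∷ L) _ with foldr-selective ⊓-sel (width T) (mapL width L)
... | inj₁ min≡T = T , here refl , sym (trans (minWidth-∷ T L) min≡T)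
... | inj₂ min∈L with ∈-map⁻ width min∈L
...   | m , m∈L , min≡m = m , there m∈L , sym (trans (minWidth-∷ T L) min≡m)

module _ {A : Set} (p : A → Bool) where

  extract-just : ∀ xs {y ys} → extract p xs ≡ just (y , ys) → xs ↭ y ∷ ys
  extract-just (x ∷ xs) found with p x
  extract-just (x ∷ xs) refl | true = ↭-refl
  ... | false with extract p xs in found′
  extract-just (x ∷ xs) refl | false | just (y , ys) =
    ↭-trans (↭-prep x (extract-just xs found′)) (↭-swap x y ↭-refl)

  extract-nothing : ∀ xs → extract p xs ≡ nothing → All (λ x → p x ≡ false) xs
  extract-nothing [] _ = []
  extract-nothing (x ∷ xs) none with p x in px
  extract-nothing (x ∷ xs) () | true
  ... | false with extract p xs in none′
  extract-nothing (x ∷ xs) refl | false | nothing = px ∷ extract-nothing xs none′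

  extract-length : ∀ xs {y ys m} → extract p xs ≡ just (y , ys) → length xs ≤ suc m → length ys ≤ m
  extract-length xs found len = s≤s⁻¹ (subst (_≤ _) (↭-length (extract-just xs found)) len)

record FinishedCluster {n} (K : ℕ) (C R : List (Term n)) : Set where
  field
    T* : Term n
    S* : VarSet n
    members-covered : All (Covered T* S*) C
    rest-far : All (λ z → 2 * K < newLits T* S* z) R

near-member-∉-rest : ∀ {n K} {C R : List (Term n)} x z → FinishedCluster K C R →
                     x ∈ C → diffSize z x ≤ 2 * K → z ∉ R
near-member-∉-rest x z cluster x∈C z-near-x z∈R =
  <⇒≱ (All.lookup rest-far z∈R)
      (≤-trans (newLits≤diffSize T* S* x (All.lookup members-covered x∈C) z) z-near-x)
  where open FinishedCluster cluster

module _ {n : ℕ} (K : ℕ) where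

  private
    Candidate : Term n → VarSet n → Term n → Bool
    Candidate T* S* T′ = newLits T* S* T′ ≤ᵇ 2 * K

  grow-partition : ∀ fuel (T* : Term n) S* C L → let (C′ , R) = grow K fuel T* S* C L in
                   ∃[ Δ ] C′ ≡ C ++ Δ × L ↭ Δ ++ R
  grow-partition zero T* S* C L = [] , sym (++-identityʳ C) , ↭-refl
  grow-partition (suc fuel) T* S* C L with extract (Candidate T* S*) L in found
  ... | nothing = [] , sym (++-identityʳ C) , ↭-refl
  ... | just (T′ , L′) with grow-partition fuel (meet T* T′) (addSymDiff S* T* T′) (C ++ [ T′ ]) L′
  ...   | Δ , C′≡ , L′↭ = T′ ∷ Δ , trans C′≡ (++-assoc C [ T′ ] Δ) ,
                          ↭-trans (extract-just _ L found) (↭-prep T′ L′↭)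

  grow-finishes : ∀ fuel (T* : Term n) S* C L → length L ≤ fuel → All (Covered T* S*) C →
                  let (C′ , R) = grow K fuel T* S* C L in FinishedCluster K C′ R
  grow-finishes zero T* S* C [] _ C-covered = record
    { T* = T* ; S* = S* ; members-covered = C-covered ; rest-far = [] }
  grow-finishes (suc fuel) T* S* C L len C-covered with extract (Candidate T* S*) L in found
  ... | nothing = record
    { T* = T* ; S* = S* ; members-covered = C-covered
    ; rest-far = All.map (λ rejected → ≰⇒> (λ le → subst T rejected (≤⇒≤ᵇ le)))
                         (extract-nothing _ L found) }
  ... | just (T′ , L′) =
    grow-finishes fuel (meet T* T′) (addSymDiff S* T* T′) (C ++ [ T′ ]) L′
      (extract-length _ L found len)
      (++⁺ (All.map (λ {y} → covered-update T* S* T′ y) C-covered) (covered-added T* S* T′ ∷ []))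

module _ {n : ℕ} (K : ℕ) {A B : Term n}
         (B-near-A : diffSize B A ≤ 2 * K) (A-near-B : diffSize A B ≤ 2 * K) where

  clusterLoop-together : ∀ fuel L → length L ≤ fuel → A ∈ L → B ∈ L →
                         ∃[ C ] C ∈ clusterLoop K fuel L × A ∈ C × B ∈ C
  clusterLoop-together zero (_ ∷ _) () _ _
  clusterLoop-together (suc fuel) L len A∈L _ with extract (λ T → width T ≡ᵇ minWidth L) L in found
  ... | nothing with minWidth-attained L A∈L
  ...   | m , m∈L , minimal =
    ⊥-elim (subst T (All.lookup (extract-nothing _ L found) m∈L) (≡⇒≡ᵇ _ _ minimal))
  clusterLoop-together (suc fuel) L len A∈L B∈L | just (T₀ , L′)
    with grow K (length L′) T₀ (replicate n false) [ T₀ ] L′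
       | grow-partition K (length L′) T₀ (replicate n false) [ T₀ ] L′
       | grow-finishes K (length L′) T₀ (replicate n false) [ T₀ ] L′ ≤-refl (covered-initial T₀ ∷ [])
  ... | C , R | Δ , refl , L′↭ | cluster = join (side A∈L) (side B∈L)
    where
      side : ∀ {x} → x ∈ L → x ∈ T₀ ∷ Δ ⊎ x ∈ R
      side x∈L = ∈-++⁻ (T₀ ∷ Δ) (∈-resp-↭ (↭-trans (extract-just _ L found) (↭-prep T₀ L′↭)) x∈L)

      R-shorter : length R ≤ fuel
      R-shorter = ≤-trans (length-++-≤ʳ R {Δ})
                          (subst (_≤ fuel) (↭-length L′↭) (extract-length _ L found len))

      join : A ∈ T₀ ∷ Δ ⊎ A ∈ R → B ∈ T₀ ∷ Δ ⊎ B ∈ R →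
             ∃[ C ] C ∈ (T₀ ∷ Δ) ∷ clusterLoop K fuel R × A ∈ C × B ∈ C
      join (inj₁ A∈C) (inj₁ B∈C) = T₀ ∷ Δ , here refl , A∈C , B∈C
      join (inj₁ A∈C) (inj₂ B∈R) = ⊥-elim (near-member-∉-rest A B cluster A∈C B-near-A B∈R)
      join (inj₂ A∈R) (inj₁ B∈C) = ⊥-elim (near-member-∉-rest B A cluster B∈C A-near-B A∈R)
      join (inj₂ A∈R) (inj₂ B∈R) with clusterLoop-together fuel R R-shorter A∈R B∈R
      ... | C′ , C′∈ , A∈C′ , B∈C′ = C′ , there C′∈ , A∈C′ , B∈C′

Clustering-together : ∀ {n} (f : List (Term n)) K {A B} →
                      diffSize B A ≤ 2 * K → diffSize A B ≤ 2 * K → A ∈ f → B ∈ f →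
                      ∃[ C ] C ∈ Clustering f K × A ∈ C × B ∈ C
Clustering-together f K B-near-A A-near-B =
  clusterLoop-together K B-near-A A-near-B (length f) f ≤-refl

diffSize-swap-≤ : ∀ {n w K} (A B : Term n) → width A ≤ w + K → w ≤ width B → diffSize B A ≤ K →
                  diffSize A B ≤ 2 * K
diffSize-swap-≤ {w = w} {K} A B |A|≤w+K w≤|B| |B∖A|≤K = +-cancelʳ-≤ w (diffSize A B) (2 * K) (begin
  diffSize A B + w        ≤⟨ +-monoʳ-≤ (diffSize A B) w≤|B| ⟩
  diffSize A B + width B  ≡⟨ diffSize-width A B ⟩
  width A + diffSize B A  ≤⟨ +-mono-≤ |A|≤w+K |B∖A|≤K ⟩
  (w + K) + K             ≡⟨ rearrange w K ⟩
  2 * K + w               ∎)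
  where
    open ≤-Reasoning
    rearrange : ∀ w K → (w + K) + K ≡ 2 * K + w
    rearrange = solve-∀

corollary15 : (n : ℕ) (f : List (Term n)) → Unique f → (K : ℕ) → 1 ≤ K →
    (T T′ : Term n) → T ∈ f → T′ ∈ f → width T ≤ minWidth f + K →
    ((C : List (Term n)) → C ∈ Clustering f K → T ∈ C → T′ ∉ C) →
    K < diffSize T′ T
corollary15 n f _ K _ T T′ T∈f T′∈f |T|≤w+K separated with diffSize T′ T ≤? K
... | no |T′∖T|≰K = ≰⇒> |T′∖T|≰K
... | yes |T′∖T|≤K
  with Clustering-together f K (≤-trans |T′∖T|≤K (m≤n*m K 2))
                               (diffSize-swap-≤ T T′ |T|≤w+K (minWidth-≤ f T′∈f) |T′∖T|≤K)
                               T∈f T′∈f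
...   | C , C∈clusters , T∈C , T′∈C = ⊥-elim (separated C C∈clusters T∈C T′∈C)
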